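{- Let $q$ be a prime power, and let $U$ be an $[n,k]_{q^m/q}$ system which is $(h,r)_q$-evasive, where $h$ is a positive integer with $2h<k$ and $r<hm$. Then $U$ is $(2h,\,r+hm-1)_q$-evasive.
   Context: An $[n,k]_{q^m/q}$ system is an $\mathbb{F}_q$-subspace $U\subseteq\mathbb{F}_{q^m}^k$ with $\dim_{\mathbb{F}_q}(U)=n$ and $\langle U\rangle_{\mathbb{F}_{q^m}}=\mathbb{F}_{q^m}^k$. For integers $h,r$ with $0\le h<k$, $U$ is $(h,r)_q$-evasive if $\dim_{\mathbb{F}_q}(U\cap H)\le r$ for every $\mathbb{F}_{q^m}$-subspace $H$ of $\mathbb{F}_{q^m}^k$ of $\mathbb{F}_{q^m}$-dimension $h$. -}

module Defs where

open import Level using (0ℓ)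
open import Algebra.Bundles using (CommutativeRing)
open import Data.Nat using (ℕ; zero; suc; _≤_; _^_)
open import Data.Nat.Primality using (Prime)
open import Data.Fin using (Fin; zero; suc)
open import Data.Product using (Σ; ∃; _×_; _,_)
open import Data.Unit using (⊤)
open import Relation.Nullary using (¬_)
open import Relation.Binary.PropositionalEquality using (_≡_)

IsPrimePower : ℕ → Set
IsPrimePower q = Σ ℕ λ p → Σ ℕ λ e → Prime p × 1 ≤ e × q ≡ p ^ e

record IsField (L : CommutativeRing 0ℓ 0ℓ) : Set where
  open CommutativeRing L
  field
    1≉0     : ¬ (1# ≈ 0#)
    inverse : ∀ x → ¬ (x ≈ 0#) → Σ Carrier λ y → x * y ≈ 1#

module _ (L : CommutativeRing 0ℓ 0ℓ) where
  open CommutativeRing L using (Carrier; _≈_; _+_; _*_; -_; 0#; 1#)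

  Scalars : Set₁
  Scalars = Carrier → Set

  AllL : Scalars
  AllL _ = ⊤

  record IsSubfield (K : Scalars) : Set where
    field
      respects : ∀ {x y} → x ≈ y → K x → K y
      has-0    : K 0#
      has-1    : K 1#
      closed-+ : ∀ {x y} → K x → K y → K (x + y)
      closed-* : ∀ {x y} → K x → K y → K (x * y)
      closed-- : ∀ {x} → K x → K (- x)
      closed-⁻¹ : ∀ {x y} → K x → ¬ (x ≈ 0#) → x * y ≈ 1# → K y

  HasCard : Scalars → ℕ → Set
  HasCard K q = Σ (Fin q → Carrier) λ e →
      (∀ i → K (e i))
    × (∀ i j → e i ≈ e j → i ≡ j)
    × (∀ x → K x → Σ (Fin q) λ i → x ≈ e i)

  sumL : ∀ {t} → (Fin t → Carrier) → Carrier
  sumL {zero}  f = 0#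
  sumL {suc t} f = f zero + sumL {t} (λ i → f (suc i))

  ExtDegree : Scalars → ℕ → Set
  ExtDegree K m = Σ (Fin m → Carrier) λ β →
      (∀ (c : Fin m → Carrier) → (∀ i → K (c i))
         → sumL (λ i → c i * β i) ≈ 0# → ∀ i → c i ≈ 0#)
    × (∀ x → Σ (Fin m → Carrier) λ c → (∀ i → K (c i)) × x ≈ sumL (λ i → c i * β i))

  Vect : ℕ → Set
  Vect k = Fin k → Carrier

  _≈v_ : ∀ {k} → Vect k → Vect k → Set
  u ≈v v = ∀ j → u j ≈ v j

  0v : ∀ {k} → Vect k
  0v _ = 0#

  _+v_ : ∀ {k} → Vect k → Vect k → Vect k
  (u +v v) j = u j + v j

  _·v_ : ∀ {k} → Carrier → Vect k → Vect k
  (a ·v v) j = a * v j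

  sumV : ∀ {k t} → (Fin t → Vect k) → Vect k
  sumV {k} {zero}  f = 0v
  sumV {k} {suc t} f = f zero +v sumV {k} {t} (λ i → f (suc i))

  lincomb : ∀ {k t} → (Fin t → Carrier) → (Fin t → Vect k) → Vect k
  lincomb c v = sumV (λ i → c i ·v v i)

  -- V ⊆ L^k is an S-subspace (S = K for F_q-subspaces, S = AllL for F_{q^m}-subspaces)
  record IsSubspace (S : Scalars) {k : ℕ} (V : Vect k → Set) : Set where
    field
      respects : ∀ {u v} → u ≈v v → V u → V v
      has-0    : V 0v
      closed-+ : ∀ {u v} → V u → V v → V (u +v v)
      closed-· : ∀ {a v} → S a → V v → V (a ·v v)

  IsLinIndep : (S : Scalars) → ∀ {k t} → (Fin t → Vect k) → Set
  IsLinIndep S {k} {t} v = ∀ (c : Fin t → Carrier) → (∀ i → S (c i))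
    → lincomb c v ≈v 0v → ∀ i → c i ≈ 0#

  InSpan : (S : Scalars) → ∀ {k t} → (Fin t → Vect k) → Vect k → Set
  InSpan S {k} {t} v x = Σ (Fin t → Carrier) λ c → (∀ i → S (c i)) × x ≈v lincomb c v

  HasDim : (S : Scalars) → ∀ {k} → (Vect k → Set) → ℕ → Set
  HasDim S {k} V d = Σ (Fin d → Vect k) λ b →
      (∀ i → V (b i)) × IsLinIndep S b × (∀ x → V x → InSpan S b x)

  DimAtMost : (S : Scalars) → ∀ {k} → (Vect k → Set) → ℕ → Set
  DimAtMost S {k} V r = ∀ t (v : Fin t → Vect k) → (∀ i → V (v i)) → IsLinIndep S v → t ≤ r

  SpansL : ∀ {k} → (Vect k → Set) → Set
  SpansL {k} U = ∀ x → Σ ℕ λ t → Σ (Fin t → Vect k) λ u → (∀ i → U (u i)) × InSpan AllL u x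

  -- U is an [n,k]_{q^m/q} system (with F_q = K, F_{q^m} = L)
  IsSystem : (K : Scalars) → (n k : ℕ) → (Vect k → Set) → Set
  IsSystem K n k U = IsSubspace K U × HasDim K U n × SpansL U

  IsEvasive : (K : Scalars) → (k h r : ℕ) → (Vect k → Set) → Set₁
  IsEvasive K k h r U = ∀ (H : Vect k → Set) → IsSubspace AllL H → HasDim AllL H h
    → DimAtMost K (λ x → U x × H x) r

module Submission where

-- Suppose an F_{q^m}-subspace W with basis w_0, …, w_{2h-1} meets U in t = r + hm F_q-independent vectors v_j.
-- Since t < 2hm, there is a nonzero F_{q^m}-linear functional a on W such that every a(v_j) has vanishing
-- 0-th coordinate with respect to an F_q-basis of F_{q^m}: these are t F_q-linear conditions on the 2hm
-- coordinates of a. Reorder the basis so that a(w_0) ≠ 0 and let H be the kernel of a on ⟨w_0, …, w_h⟩, an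
-- h-dimensional subspace. An F_q-combination of the v_j lies in H once its coefficients on w_{h+1}, …, w_{2h-1}
-- vanish and a kills it; that is (h-1)m + (m-1) F_q-conditions, coordinate 0 of a being free. So U ∩ H contains
-- r + 1 independent vectors, contradicting (h, r)-evasiveness.

open import Defs
open import Level using (0ℓ)
open import Algebra.Bundles using (CommutativeRing)
open import Data.Nat as ℕ using (ℕ; zero; suc; s≤s⁻¹)
open import Data.Nat.Tactic.RingSolver using (solve-∀)
import Data.Nat.Properties as ℕₚ
open import Data.Nat.Properties
  using (module ≤-Reasoning; +-monoˡ-≤; 1+n≰n; m+n≤o⇒n≤o; ≤-trans; ≤-reflexive; +-suc)
open import Data.Fin using (Fin; zero; suc; _↑ˡ_; _↑ʳ_; splitAt; join; combine; remQuot; punchIn; punchOut; _≟_)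
open import Data.Sum using (_⊎_; inj₁; inj₂)
open import Data.Empty using (⊥; ⊥-elim)
open import Data.Fin.Properties
  using (join-splitAt; remQuot-combine; combine-remQuot; punchInᵢ≢i; punchIn-punchOut; all?; ¬∀⟶∃¬)
open import Relation.Nullary using (¬_; Dec; yes; no)
open import Data.Vec.Functional using (_∷_; _++_; concat; updateAt)
open import Data.Vec.Functional.Properties using (lookup-++ˡ; lookup-++ʳ; updateAt-updates; updateAt-minimal)
open import Data.Product using (Σ; _×_; _,_; proj₁; proj₂; swap; uncurry)
open import Data.Fin.Permutation using (Permutation; _⟨$⟩ʳ_; _⟨$⟩ˡ_; inverseˡ; insert; cast-id)
open import Function using (flip; _∘_)
open import Relation.Binary.PropositionalEquality as ≡ using (_≡_)
import Relation.Binary.Reasoning.Setoid as SetoidReasoning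
import Algebra.Properties.Semiring.Sum as SemiringSum
import Algebra.Properties.Ring as RingProperties
import Algebra.Properties.CommutativeSemigroup as CommutativeSemigroupProperties

module Sums (L : CommutativeRing 0ℓ 0ℓ) where
  open CommutativeRing L hiding (zero)
  open SemiringSum semiring public
  open RingProperties ring public
    using (-‿distribˡ-*; -‿distribʳ-*; +-inverseʳ-unique; x∙y⁻¹≈ε⇒x≈y)
  open CommutativeSemigroupProperties *-commutativeSemigroup public using (x∙yz≈y∙xz)
  open SetoidReasoning setoid

  infix 4 _≈ᵥ_
  _≈ᵥ_ : ∀ {k} → Vect L k → Vect L k → Set
  _≈ᵥ_ = _≈v_ L

  sumL≡sum : ∀ {n} (f : Fin n → Carrier) → sumL L f ≡ sum f
  sumL≡sum {zero}  f = ≡.refl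
  sumL≡sum {suc n} f = ≡.cong (f zero +_) (sumL≡sum (f ∘ suc))

  sum-≈0 : ∀ {n} {f : Fin n → Carrier} → (∀ i → f i ≈ 0#) → sum f ≈ 0#
  sum-≈0 {n} f≈0 = trans (sum-cong-≋ f≈0) (sum-replicate-zero n)

  sum-neg : ∀ {n} (f : Fin n → Carrier) → sum (λ i → - f i) ≈ - sum f
  sum-neg f = +-inverseʳ-unique (sum f) _ (begin
    sum f + sum (λ i → - f i) ≈⟨ sym (∑-distrib-+ f _) ⟩
    sum (λ i → f i + - f i)   ≈⟨ sum-≈0 (λ i → -‿inverseʳ (f i)) ⟩
    0#                        ∎)

  sum-++ : ∀ m n (f : Fin (m ℕ.+ n) → Carrier) → sum f ≈ sum (λ i → f (i ↑ˡ n)) + sum (λ i → f (m ↑ʳ i))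
  sum-++ zero    n f = sym (+-identityˡ _)
  sum-++ (suc m) n f = trans (+-congˡ (sum-++ m n (f ∘ suc))) (sym (+-assoc _ _ _))

  sum-combine : ∀ m n (f : Fin (m ℕ.* n) → Carrier) → sum f ≈ ∑[ i < m ] ∑[ l < n ] f (combine i l)
  sum-combine zero    n f = refl
  sum-combine (suc m) n f = trans (sum-++ n (m ℕ.* n) f) (+-congˡ (sum-combine m n (f ∘ (n ↑ʳ_))))

  ≈-by-splitAt : ∀ {m n} {f g : Fin (m ℕ.+ n) → Carrier}
    → (∀ i → f (i ↑ˡ n) ≈ g (i ↑ˡ n)) → (∀ i → f (m ↑ʳ i) ≈ g (m ↑ʳ i)) → ∀ i → f i ≈ g i
  ≈-by-splitAt {m} {n} {f} {g} f≈gˡ f≈gʳ i =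
    ≡.subst (λ i → f i ≈ g i) (join-splitAt m n i) (on-join (splitAt m i))
    where
    on-join : ∀ s → f (join m n s) ≈ g (join m n s)
    on-join (inj₁ i) = f≈gˡ i
    on-join (inj₂ i) = f≈gʳ i

  lincomb-apply : ∀ {k t} (c : Fin t → Carrier) (v : Fin t → Vect L k) j
    → lincomb L c v j ≡ ∑[ i < t ] (c i * v i j)
  lincomb-apply {t = zero}  c v j = ≡.refl
  lincomb-apply {t = suc t} c v j = ≡.cong (c zero * v zero j +_) (lincomb-apply (c ∘ suc) (v ∘ suc) j)

lookup-concat : ∀ {A : Set} {m n} (xss : Fin n → Fin m → A) i l → concat xss (combine i l) ≡ xss i l
lookup-concat xss i l = ≡.cong (uncurry (flip xss) ∘ swap) (remQuot-combine i l)

module Spans (L : CommutativeRing 0ℓ 0ℓ) where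
  open CommutativeRing L hiding (zero)
  open Sums L
  open SetoidReasoning setoid

  lincomb-cong : ∀ {k t} {c d : Fin t → Carrier} {v w : Fin t → Vect L k}
    → (∀ i → c i ≈ d i) → (∀ i → v i ≈ᵥ w i) → lincomb L c v ≈ᵥ lincomb L d w
  lincomb-cong {t = zero}  c≈d v≈w κ = refl
  lincomb-cong {t = suc t} c≈d v≈w κ =
    +-cong (*-cong (c≈d zero) (v≈w zero κ)) (lincomb-cong (c≈d ∘ suc) (v≈w ∘ suc) κ)

  lincomb-lincomb : ∀ {k s t} (d : Fin s → Carrier) (C : Fin s → Vect L t) (v : Fin t → Vect L k)
    → lincomb L d (λ p → lincomb L (C p) v) ≈ᵥ lincomb L (lincomb L d C) v
  lincomb-lincomb {s = s} {t} d C v κ = begin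
    lincomb L d (λ p → lincomb L (C p) v) κ
      ≡⟨ lincomb-apply d _ κ ⟩
    ∑[ p < s ] (d p * lincomb L (C p) v κ)
      ≡⟨ sum-cong-≗ (λ p → ≡.cong (d p *_) (lincomb-apply (C p) v κ)) ⟩
    ∑[ p < s ] (d p * ∑[ j < t ] (C p j * v j κ))
      ≈⟨ sum-cong-≋ (λ p → *-distribˡ-sum (d p) (λ j → C p j * v j κ)) ⟩
    ∑[ p < s ] ∑[ j < t ] (d p * (C p j * v j κ))
      ≈⟨ ∑-comm (λ p j → d p * (C p j * v j κ)) ⟩
    ∑[ j < t ] ∑[ p < s ] (d p * (C p j * v j κ))
      ≈⟨ sum-cong-≋ (λ j → sum-cong-≋ (λ p → sym (*-assoc (d p) (C p j) (v j κ)))) ⟩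
    ∑[ j < t ] ∑[ p < s ] (d p * C p j * v j κ)
      ≈⟨ sum-cong-≋ (λ j → sym (*-distribʳ-sum (v j κ) (λ p → d p * C p j))) ⟩
    ∑[ j < t ] (∑[ p < s ] (d p * C p j) * v j κ)
      ≡⟨ sum-cong-≗ (λ j → ≡.cong (_* v j κ) (lincomb-apply d C j)) ⟨
    ∑[ j < t ] (lincomb L d C j * v j κ)
      ≡⟨ lincomb-apply (lincomb L d C) v κ ⟨
    lincomb L (lincomb L d C) v κ ∎

  sum-*-lincomb : ∀ {n t} (a : Fin n → Carrier) (c : Fin t → Carrier) (x : Fin t → Vect L n)
    → ∑[ i < n ] (a i * lincomb L c x i) ≈ ∑[ j < t ] (c j * ∑[ i < n ] (a i * x j i))
  sum-*-lincomb {n} {t} a c x = begin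
    ∑[ i < n ] (a i * lincomb L c x i)
      ≡⟨ sum-cong-≗ (λ i → ≡.cong (a i *_) (lincomb-apply c x i)) ⟩
    ∑[ i < n ] (a i * ∑[ j < t ] (c j * x j i))
      ≈⟨ sum-cong-≋ (λ i → *-distribˡ-sum (a i) (λ j → c j * x j i)) ⟩
    ∑[ i < n ] ∑[ j < t ] (a i * (c j * x j i))
      ≈⟨ ∑-comm (λ i j → a i * (c j * x j i)) ⟩
    ∑[ j < t ] ∑[ i < n ] (a i * (c j * x j i))
      ≈⟨ sum-cong-≋ (λ j → sum-cong-≋ (λ i → x∙yz≈y∙xz (a i) (c j) (x j i))) ⟩
    ∑[ j < t ] ∑[ i < n ] (c j * (a i * x j i))
      ≈⟨ sum-cong-≋ (λ j → *-distribˡ-sum (c j) (λ i → a i * x j i)) ⟨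
    ∑[ j < t ] (c j * ∑[ i < n ] (a i * x j i)) ∎

  lincomb-permute : ∀ {k m n} (π : Permutation m n) (c : Fin n → Carrier) (v : Fin n → Vect L k)
    → lincomb L c v ≈ᵥ lincomb L (c ∘ (π ⟨$⟩ʳ_)) (v ∘ (π ⟨$⟩ʳ_))
  lincomb-permute π c v κ = begin
    lincomb L c v κ                                   ≡⟨ lincomb-apply c v κ ⟩
    sum (λ i → c i * v i κ)                           ≈⟨ ∑-permute _ π ⟩
    sum (λ i → c (π ⟨$⟩ʳ i) * v (π ⟨$⟩ʳ i) κ)          ≡⟨ lincomb-apply (c ∘ (π ⟨$⟩ʳ_)) (v ∘ (π ⟨$⟩ʳ_)) κ ⟨
    lincomb L (c ∘ (π ⟨$⟩ʳ_)) (v ∘ (π ⟨$⟩ʳ_)) κ        ∎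

  IsLinIndep-permute : ∀ {S k m n} (π : Permutation m n) {v : Fin n → Vect L k}
    → IsLinIndep L S v → IsLinIndep L S (v ∘ (π ⟨$⟩ʳ_))
  IsLinIndep-permute {S} π {v} v-indep d d∈S dv≈0 i =
    trans (reflexive (≡.cong d (≡.sym (inverseˡ π))))
          (v-indep d′ (d∈S ∘ (π ⟨$⟩ˡ_)) d′v≈0 (π ⟨$⟩ʳ i))
    where
    d′ = d ∘ (π ⟨$⟩ˡ_)
    d′v≈0 : lincomb L d′ v ≈ᵥ 0v L
    d′v≈0 κ = trans (lincomb-permute π d′ v κ)
      (trans (lincomb-cong {c = d′ ∘ (π ⟨$⟩ʳ_)} {d = d} (λ _ → reflexive (≡.cong d (inverseˡ π))) (λ _ _ → refl) κ)
             (dv≈0 κ))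

  lincomb-++ : ∀ {k m n} (c : Fin m → Carrier) (v : Fin (m ℕ.+ n) → Vect L k)
    → lincomb L (c ++ λ _ → 0#) v ≈ᵥ lincomb L c (λ i → v (i ↑ˡ n))
  lincomb-++ {m = m} {n} c v κ = begin
    lincomb L c′ v κ                                                            ≡⟨ lincomb-apply c′ v κ ⟩
    sum (λ i → c′ i * v i κ)                                                    ≈⟨ sum-++ m n _ ⟩
    sum (λ i → c′ (i ↑ˡ n) * v (i ↑ˡ n) κ) + sum (λ i → c′ (m ↑ʳ i) * v (m ↑ʳ i) κ)
      ≈⟨ +-cong (sum-cong-≋ (λ i → *-congʳ (reflexive (lookup-++ˡ c _ i))))
                (sum-≈0 (λ i → trans (*-congʳ (reflexive (lookup-++ʳ c _ i))) (zeroˡ (v (m ↑ʳ i) κ)))) ⟩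
    sum (λ i → c i * v (i ↑ˡ n) κ) + 0#                                         ≈⟨ +-identityʳ _ ⟩
    sum (λ i → c i * v (i ↑ˡ n) κ)                                              ≡⟨ lincomb-apply c _ κ ⟨
    lincomb L c (λ i → v (i ↑ˡ n)) κ                                            ∎
    where c′ = c ++ λ _ → 0#

  IsLinIndep-↑ˡ : ∀ {S k m n} {v : Fin (m ℕ.+ n) → Vect L k} → S 0#
    → IsLinIndep L S v → IsLinIndep L S (λ i → v (i ↑ˡ n))
  IsLinIndep-↑ˡ {S} {m = m} {n} {v} 0∈S v-indep c c∈S cv≈0 i =
    trans (reflexive (≡.sym (lookup-++ˡ c _ i)))
          (v-indep (c ++ λ _ → 0#) c′∈S (λ κ → trans (lincomb-++ c v κ) (cv≈0 κ)) (i ↑ˡ n))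
    where
    c′∈S : ∀ j → S ((c ++ λ _ → 0#) j)
    c′∈S j with splitAt m j
    ... | inj₁ i = c∈S i
    ... | inj₂ _ = 0∈S

  indicator : ∀ {t} → Fin t → Fin t → Carrier
  indicator j = updateAt (λ _ → 0#) j (λ _ → 1#)

  indicator-∈ : ∀ {S : Scalars L} {t} → S 0# → S 1# → (j i : Fin t) → S (indicator j i)
  indicator-∈ {S} 0∈S 1∈S j i with i ≟ j
  ... | yes ≡.refl = ≡.subst S (≡.sym (updateAt-updates j _)) 1∈S
  ... | no i≢j     = ≡.subst S (≡.sym (updateAt-minimal i j _ i≢j)) 0∈S

  lincomb-indicator : ∀ {k t} (v : Fin t → Vect L k) j → lincomb L (indicator j) v ≈ᵥ v j
  lincomb-indicator {t = suc t} v j κ = begin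
    lincomb L e v κ                                               ≡⟨ lincomb-apply e v κ ⟩
    sum (λ i → e i * v i κ)                                       ≈⟨ sum-remove {i = j} (λ i → e i * v i κ) ⟩
    e j * v j κ + sum (λ i → e (punchIn j i) * v (punchIn j i) κ)
      ≈⟨ +-cong (*-congʳ (reflexive (updateAt-updates j _)))
                (sum-≈0 (λ i → trans (*-congʳ (reflexive (updateAt-minimal _ j _ (punchInᵢ≢i j i))))
                                     (zeroˡ (v (punchIn j i) κ)))) ⟩
    1# * v j κ + 0#                                               ≈⟨ +-identityʳ _ ⟩
    1# * v j κ                                                    ≈⟨ *-identityˡ _ ⟩
    v j κ                                                         ∎
    where e = indicator j

  InSpan-member : ∀ {S k t} → S 0# → S 1# → (v : Fin t → Vect L k) → ∀ j → InSpan L S v (v j)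
  InSpan-member {S} 0∈S 1∈S v j = indicator j , indicator-∈ {S} 0∈S 1∈S j , λ κ → sym (lincomb-indicator v j κ)

  InSpan-isSubspace : ∀ {k t} (v : Fin t → Vect L k) → IsSubspace L (AllL L) (InSpan L (AllL L) v)
  InSpan-isSubspace {t = t} v = record
    { respects = λ { x≈y (c , _ , x≈cv) → c , _ , λ κ → trans (sym (x≈y κ)) (x≈cv κ) }
    ; has-0    = (λ _ → 0#) , _ , λ κ →
        sym (trans (reflexive (lincomb-apply _ v κ)) (sum-≈0 (λ i → zeroˡ (v i κ))))
    ; closed-+ = λ { (c , _ , x≈cv) (d , _ , y≈dv) → (λ i → c i + d i) , _ , λ κ → begin
        _ ≈⟨ +-cong (x≈cv κ) (y≈dv κ) ⟩
        lincomb L c v κ + lincomb L d v κ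
          ≡⟨ ≡.cong₂ _+_ (lincomb-apply c v κ) (lincomb-apply d v κ) ⟩
        sum (λ i → c i * v i κ) + sum (λ i → d i * v i κ)
          ≈⟨ ∑-distrib-+ (λ i → c i * v i κ) (λ i → d i * v i κ) ⟨
        sum (λ i → c i * v i κ + d i * v i κ)              ≈⟨ sum-cong-≋ (λ i → distribʳ (v i κ) (c i) (d i)) ⟨
        sum (λ i → (c i + d i) * v i κ)                    ≡⟨ lincomb-apply _ v κ ⟨
        lincomb L (λ i → c i + d i) v κ                    ∎ }
    ; closed-· = λ { {a} _ (c , _ , x≈cv) → (λ i → a * c i) , _ , λ κ → begin
        _ ≈⟨ *-congˡ (x≈cv κ) ⟩
        a * lincomb L c v κ                         ≡⟨ ≡.cong (a *_) (lincomb-apply c v κ) ⟩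
        a * sum (λ i → c i * v i κ)                 ≈⟨ *-distribˡ-sum a (λ i → c i * v i κ) ⟩
        sum (λ i → a * (c i * v i κ))               ≈⟨ sum-cong-≋ (λ i → *-assoc a (c i) (v i κ)) ⟨
        sum (λ i → a * c i * v i κ)                 ≡⟨ lincomb-apply _ v κ ⟨
        lincomb L (λ i → a * c i) v κ               ∎ }
    }

  lincomb-closed : ∀ {S k t} {V : Vect L k → Set} → IsSubspace L S V
    → {c : Fin t → Carrier} → (∀ i → S (c i)) → {v : Fin t → Vect L k} → (∀ i → V (v i)) → V (lincomb L c v)
  lincomb-closed {t = zero}  V-sub c∈S v∈V = IsSubspace.has-0 V-sub
  lincomb-closed {t = suc t} V-sub c∈S v∈V = IsSubspace.closed-+ V-sub
    (IsSubspace.closed-· V-sub (c∈S zero) (v∈V zero)) (lincomb-closed V-sub (c∈S ∘ suc) (v∈V ∘ suc))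

  DimAtMost-∸1 : ∀ {S k t} {V : Vect L k → Set} → S 0#
    → ((v : Fin t → Vect L k) → (∀ i → V (v i)) → IsLinIndep L S v → ⊥) → DimAtMost L S V (t ℕ.∸ 1)
  DimAtMost-∸1 {S} {t = t} 0∈S no-t-family t′ v v∈V v-indep with t′ ℕ.≤? t ℕ.∸ 1
  ... | yes t′≤t-1 = t′≤t-1
  ... | no  t′≰t-1 with ℕₚ.m≤n⇒∃[o]m+o≡n (ℕₚ.≤-trans (ℕₚ.m≤n+m∸n t 1) (ℕₚ.≰⇒> t′≰t-1))
  ...   | e , ≡.refl =
    ⊥-elim (no-t-family (λ i → v (i ↑ˡ e)) (λ i → v∈V (i ↑ˡ e)) (IsLinIndep-↑ˡ {S} 0∈S v-indep))

  lincomb-tail : ∀ {k t} (d : Fin t → Carrier) (V : Fin t → Vect L (suc k)) j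
    → lincomb L d V (suc j) ≡ lincomb L d (λ p → V p ∘ suc) j
  lincomb-tail d V j = ≡.trans (lincomb-apply d V (suc j)) (≡.sym (lincomb-apply d (λ p → V p ∘ suc) j))

  IsLinIndep-tail : ∀ {S k t} {V : Fin t → Vect L (suc k)} → IsLinIndep L S (λ p → V p ∘ suc) → IsLinIndep L S V
  IsLinIndep-tail {V = V} tails-indep d d∈S dV≈0 =
    tails-indep d d∈S (λ j → trans (reflexive (≡.sym (lincomb-tail d V j))) (dV≈0 (suc j)))

  IsLinIndep⇒nonzero : ∀ {S k t} {v : Fin t → Vect L k} → S 0# → S 1# → ¬ 1# ≈ 0#
    → IsLinIndep L S v → ∀ p → ¬ (∀ κ → v p κ ≈ 0#)
  IsLinIndep⇒nonzero {S} {v = v} 0∈S 1∈S 1≉0 v-indep p vp≈0 = 1≉0 (begin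
    1#            ≡⟨ updateAt-updates p _ ⟨
    indicator p p ≈⟨ v-indep (indicator p) (indicator-∈ {S} 0∈S 1∈S p)
                             (λ κ → trans (lincomb-indicator v p κ) (vp≈0 κ)) p ⟩
    0#            ∎)

module Subfield (L : CommutativeRing 0ℓ 0ℓ) (K : Scalars L) (K-subfield : IsSubfield L K) where
  open CommutativeRing L hiding (zero)
  open Sums L
  open Spans L
  private module K = IsSubfield K-subfield

  HasCard⇒≈? : ∀ {q} → HasCard L K q → ∀ {x y} → K x → K y → Dec (x ≈ y)
  HasCard⇒≈? (e , _ , e-injective , e-onto) {x} {y} x∈K y∈K
    with e-onto x x∈K | e-onto y y∈K
  ... | i , x≈eᵢ | j , y≈eⱼ with i ≟ j
  ...   | yes ≡.refl = yes (trans x≈eᵢ (sym y≈eⱼ))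
  ...   | no  i≢j    = no (λ x≈y → i≢j (e-injective i j (trans (sym x≈eᵢ) (trans x≈y y≈eⱼ))))

  sum-∈K : ∀ {t} {f : Fin t → Carrier} → (∀ i → K (f i)) → K (sum f)
  sum-∈K {zero}  f∈K = K.has-0
  sum-∈K {suc t} f∈K = K.closed-+ (f∈K zero) (sum-∈K (f∈K ∘ suc))

  IsLinIndep-lincomb : ∀ {k s t} {C : Fin s → Vect L t} {v : Fin t → Vect L k} → (∀ p j → K (C p j))
    → IsLinIndep L K C → IsLinIndep L K v → IsLinIndep L K (λ p → lincomb L (C p) v)
  IsLinIndep-lincomb {C = C} {v} C∈K C-indep v-indep d d∈K du≈0 =
    C-indep d d∈K (v-indep (lincomb L d C) dC∈K (λ κ → trans (sym (lincomb-lincomb d C v κ)) (du≈0 κ)))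
    where
    dC∈K : ∀ j → K (lincomb L d C j)
    dC∈K j = ≡.subst K (≡.sym (lincomb-apply d C j)) (sum-∈K (λ p → K.closed-* (d∈K p) (C∈K p j)))

module Kernels (L : CommutativeRing 0ℓ 0ℓ) (L-field : IsField L) (K : Scalars L) (K-subfield : IsSubfield L K)
               (K-≈0? : ∀ {x} → K x → Dec (CommutativeRing._≈_ L x (CommutativeRing.0# L))) where
  open CommutativeRing L hiding (zero)
  open IsField L-field
  open Sums L
  open Spans L
  open SetoidReasoning setoid
  open Subfield L K K-subfield
  private module K = IsSubfield K-subfield

  ≈0-or-nonzero : ∀ {E} (g : Fin E → Carrier) → (∀ e → K (g e))
    → (∀ e → g e ≈ 0#) ⊎ Σ (Fin E) λ e → ¬ g e ≈ 0#
  ≈0-or-nonzero {E} g g∈K with all? (λ e → K-≈0? (g∈K e))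
  ... | yes g≈0 = inj₁ g≈0
  ... | no  g≉0 = inj₂ (¬∀⟶∃¬ E _ (λ e → K-≈0? (g∈K e)) g≉0)

  record KernelFamily {E t} (A : Fin E → Fin t → Carrier) (s : ℕ) : Set where
    field
      vec        : Fin s → Vect L t
      vec-∈K     : ∀ p j → K (vec p j)
      vec-kernel : ∀ p e → ∑[ j < t ] (A e j * vec p j) ≈ 0#
      vec-indep  : IsLinIndep L K vec

  KernelFamily-zeroColumn : ∀ {E t s} (A : Fin E → Fin (suc t) → Carrier) → (∀ e → A e zero ≈ 0#)
    → KernelFamily (λ e → A e ∘ suc) s → KernelFamily A (suc s)
  KernelFamily-zeroColumn {s = s} A A₀≈0 F = record
    { vec = vec′ ; vec-∈K = vec′-∈K ; vec-kernel = vec′-kernel ; vec-indep = vec′-indep }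
    where
    open KernelFamily F
    vec′ : Fin (suc s) → Vect L _
    vec′ = (1# ∷ λ _ → 0#) ∷ λ p → 0# ∷ vec p
    vec′-∈K : ∀ p j → K (vec′ p j)
    vec′-∈K zero    zero    = K.has-1
    vec′-∈K zero    (suc j) = K.has-0
    vec′-∈K (suc p) zero    = K.has-0
    vec′-∈K (suc p) (suc j) = vec-∈K p j
    vec′-kernel : ∀ p e → sum (λ j → A e j * vec′ p j) ≈ 0#
    vec′-kernel zero    e = trans (+-cong (trans (*-identityʳ _) (A₀≈0 e)) (sum-≈0 (λ j → zeroʳ (A e (suc j)))))
                                  (+-identityʳ 0#)
    vec′-kernel (suc p) e = trans (+-cong (zeroʳ _) (vec-kernel p e)) (+-identityʳ 0#)
    vec′-indep : IsLinIndep L K vec′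
    vec′-indep d d∈K dv≈0 zero = begin
      d zero                                          ≈⟨ *-identityʳ _ ⟨
      d zero * 1#                                     ≈⟨ +-identityʳ _ ⟨
      d zero * 1# + 0#                                ≈⟨ +-congˡ (sum-≈0 (λ p → zeroʳ (d (suc p)))) ⟨
      d zero * 1# + sum (λ p → d (suc p) * 0#)        ≡⟨ lincomb-apply d vec′ zero ⟨
      lincomb L d vec′ zero                           ≈⟨ dv≈0 zero ⟩
      0#                                              ∎
    vec′-indep d d∈K dv≈0 (suc p) = vec-indep (d ∘ suc) (d∈K ∘ suc) (λ j → begin
      lincomb L (d ∘ suc) vec j                                 ≡⟨ lincomb-tail (d ∘ suc) (vec′ ∘ suc) j ⟨
      lincomb L (d ∘ suc) (vec′ ∘ suc) (suc j)                  ≈⟨ +-identityˡ _ ⟨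
      0# + lincomb L (d ∘ suc) (vec′ ∘ suc) (suc j)             ≈⟨ +-congʳ (zeroʳ (d zero)) ⟨
      lincomb L d vec′ (suc j)                                  ≈⟨ dv≈0 (suc j) ⟩
      0#                                                        ∎) p

  module _ {E t} (A : Fin (suc E) → Fin (suc t) → Carrier) (e₀ : Fin (suc E)) (p≉0 : ¬ A e₀ zero ≈ 0#) where
    private
      p⁻¹ = proj₁ (inverse (A e₀ zero) p≉0)
      p*p⁻¹≈1 = proj₂ (inverse (A e₀ zero) p≉0)

    eliminate : Fin E → Fin t → Carrier
    eliminate e j = A (punchIn e₀ e) (suc j) - A (punchIn e₀ e) zero * (p⁻¹ * A e₀ (suc j))

    private
      p⁻¹∈K : (∀ e j → K (A e j)) → K p⁻¹
      p⁻¹∈K A∈K = K.closed-⁻¹ (A∈K e₀ zero) p≉0 p*p⁻¹≈1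

    eliminate-∈K : (∀ e j → K (A e j)) → ∀ e j → K (eliminate e j)
    eliminate-∈K A∈K e j =
      K.closed-+ (A∈K _ _) (K.closed-- (K.closed-* (A∈K _ _) (K.closed-* (p⁻¹∈K A∈K) (A∈K _ _))))

    KernelFamily-eliminate : ∀ {s} → (∀ e j → K (A e j)) → KernelFamily eliminate s → KernelFamily A s
    KernelFamily-eliminate {s} A∈K F = record
      { vec = vec′ ; vec-∈K = vec′-∈K ; vec-kernel = vec′-kernel
      ; vec-indep = IsLinIndep-tail {S = K} vec-indep }
      where
      open KernelFamily F
      pivotRow : Fin s → Carrier
      pivotRow p = sum (λ j → A e₀ (suc j) * vec p j)
      vec′ : Fin s → Vect L (suc t)
      vec′ p = - (p⁻¹ * pivotRow p) ∷ vec p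
      vec′-∈K : ∀ p j → K (vec′ p j)
      vec′-∈K p zero    =
        K.closed-- (K.closed-* (p⁻¹∈K A∈K) (sum-∈K (λ j → K.closed-* (A∈K e₀ (suc j)) (vec-∈K p j))))
      vec′-∈K p (suc j) = vec-∈K p j
      row-eliminated : ∀ p e → sum (λ j → A e j * vec′ p j)
        ≈ sum (λ j → (A e (suc j) - A e zero * (p⁻¹ * A e₀ (suc j))) * vec p j)
      row-eliminated p e = sym (begin
        sum (λ j → (a j - α * (p⁻¹ * g j)) * c j)      ≈⟨ sum-cong-≋ (λ j → distribʳ (c j) (a j) _) ⟩
        sum (λ j → a j * c j + - (α * (p⁻¹ * g j)) * c j)
          ≈⟨ sum-cong-≋ (λ j → +-congˡ (trans (sym (-‿distribˡ-* _ (c j)))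
               (-‿cong (trans (*-assoc α _ (c j)) (*-congˡ (*-assoc p⁻¹ (g j) (c j))))))) ⟩
        sum (λ j → a j * c j + - (α * (p⁻¹ * (g j * c j))))
          ≈⟨ ∑-distrib-+ (λ j → a j * c j) (λ j → - (α * (p⁻¹ * (g j * c j)))) ⟩
        sum (λ j → a j * c j) + sum (λ j → - (α * (p⁻¹ * (g j * c j))))
          ≈⟨ +-congˡ (sum-neg (λ j → α * (p⁻¹ * (g j * c j)))) ⟩
        sum (λ j → a j * c j) + - sum (λ j → α * (p⁻¹ * (g j * c j)))
          ≈⟨ +-congˡ (-‿cong (trans (sym (*-distribˡ-sum α (λ j → p⁻¹ * (g j * c j))))
                                     (*-congˡ (sym (*-distribˡ-sum p⁻¹ (λ j → g j * c j)))))) ⟩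
        sum (λ j → a j * c j) + - (α * (p⁻¹ * pivotRow p)) ≈⟨ +-congˡ (-‿distribʳ-* α _) ⟩
        sum (λ j → a j * c j) + α * - (p⁻¹ * pivotRow p)   ≈⟨ +-comm _ _ ⟩
        α * - (p⁻¹ * pivotRow p) + sum (λ j → a j * c j)   ∎)
        where
        α = A e zero
        a = λ j → A e (suc j)
        g = λ j → A e₀ (suc j)
        c = vec p
      vec′-kernel : ∀ p e → sum (λ j → A e j * vec′ p j) ≈ 0#
      vec′-kernel p e with e₀ ≟ e
      ... | yes ≡.refl = begin
        A e₀ zero * - (p⁻¹ * pivotRow p) + pivotRow p
          ≈⟨ +-congʳ (trans (sym (-‿distribʳ-* _ _)) (-‿cong (sym (*-assoc _ _ _)))) ⟩
        - (A e₀ zero * p⁻¹ * pivotRow p) + pivotRow p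
          ≈⟨ +-congʳ (-‿cong (trans (*-congʳ p*p⁻¹≈1) (*-identityˡ _))) ⟩
        - pivotRow p + pivotRow p                      ≈⟨ -‿inverseˡ _ ⟩
        0#                                             ∎
      ... | no e₀≢e = ≡.subst (λ e → sum (λ j → A e j * vec′ p j) ≈ 0#) (punchIn-punchOut e₀≢e)
                              (trans (row-eliminated p _) (vec-kernel p (punchOut e₀≢e)))

  kernelFamily : ∀ {E t s} → E ℕ.+ s ℕ.≤ t → (A : Fin E → Fin t → Carrier) → (∀ e j → K (A e j))
    → KernelFamily A s
  kernelFamily {s = zero} _ A _ =
    record { vec = λ () ; vec-∈K = λ () ; vec-kernel = λ () ; vec-indep = λ _ _ _ () }
  kernelFamily {E} {zero} {suc s} E+s≤0 A _ with () ← m+n≤o⇒n≤o E E+s≤0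
  kernelFamily {zero} {suc t} {suc s} s≤t A A∈K =
    KernelFamily-zeroColumn A (λ ()) (kernelFamily (s≤s⁻¹ s≤t) (λ e → A e ∘ suc) (λ e j → A∈K e (suc j)))
  kernelFamily {suc E} {suc t} {suc s} le A A∈K with ≈0-or-nonzero (λ e → A e zero) (λ e → A∈K e zero)
  ... | inj₁ col≈0 = KernelFamily-zeroColumn A col≈0
        (kernelFamily (s≤s⁻¹ (≤-trans (≤-reflexive (≡.sym (+-suc (suc E) s))) le))
                      (λ e → A e ∘ suc) (λ e j → A∈K e (suc j)))
  ... | inj₂ (e₀ , p≉0) = KernelFamily-eliminate A e₀ p≉0 A∈K
        (kernelFamily (s≤s⁻¹ le) (eliminate A e₀ p≉0) (eliminate-∈K A e₀ p≉0 A∈K))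

module Coordinates (L : CommutativeRing 0ℓ 0ℓ) (K : Scalars L) (K-subfield : IsSubfield L K)
                   {m : ℕ} (K-basis : ExtDegree L K m) where
  open CommutativeRing L hiding (zero)
  open Sums L
  open Subfield L K K-subfield
  open SetoidReasoning setoid
  private module K = IsSubfield K-subfield

  β : Fin m → Carrier
  β = proj₁ K-basis

  β-indep : ∀ (γ : Fin m → Carrier) → (∀ l → K (γ l)) → ∑[ l < m ] (γ l * β l) ≈ 0# → ∀ l → γ l ≈ 0#
  β-indep γ γ∈K γβ≈0 = proj₁ (proj₂ K-basis) γ γ∈K (trans (reflexive (sumL≡sum (λ l → γ l * β l))) γβ≈0)

  coord : Carrier → Fin m → Carrier
  coord x = proj₁ (proj₂ (proj₂ K-basis) x)

  coord-∈K : ∀ x l → K (coord x l)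
  coord-∈K x = proj₁ (proj₂ (proj₂ (proj₂ K-basis) x))

  coord-expand : ∀ x → x ≈ ∑[ l < m ] (coord x l * β l)
  coord-expand x =
    trans (proj₂ (proj₂ (proj₂ (proj₂ K-basis) x))) (reflexive (sumL≡sum (λ l → coord x l * β l)))

  coord-unique : ∀ x (γ : Fin m → Carrier) → (∀ l → K (γ l)) → x ≈ ∑[ l < m ] (γ l * β l)
    → ∀ l → coord x l ≈ γ l
  coord-unique x γ γ∈K x≈γβ l = x∙y⁻¹≈ε⇒x≈y _ _ (β-indep (λ l → coord x l - γ l)
    (λ l → K.closed-+ (coord-∈K x l) (K.closed-- (γ∈K l))) (begin
      sum (λ l → (coord x l - γ l) * β l)
        ≈⟨ sum-cong-≋ (λ l → trans (distribʳ (β l) _ _) (+-congˡ (sym (-‿distribˡ-* (γ l) (β l))))) ⟩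
      sum (λ l → coord x l * β l + - (γ l * β l))
        ≈⟨ ∑-distrib-+ (λ l → coord x l * β l) (λ l → - (γ l * β l)) ⟩
      sum (λ l → coord x l * β l) + sum (λ l → - (γ l * β l))
        ≈⟨ +-cong (sym (coord-expand x)) (sum-neg (λ l → γ l * β l)) ⟩
      x - sum (λ l → γ l * β l)                         ≈⟨ +-congˡ (-‿cong (sym x≈γβ)) ⟩
      x - x                                             ≈⟨ -‿inverseʳ x ⟩
      0#                                                ∎) l)

  coord-cong : ∀ {x y} → x ≈ y → ∀ l → coord x l ≈ coord y l
  coord-cong {x} {y} x≈y = coord-unique x (coord y) (coord-∈K y) (trans x≈y (coord-expand y))

  coord≈0⇒≈0 : ∀ x → (∀ l → coord x l ≈ 0#) → x ≈ 0#
  coord≈0⇒≈0 x coord≈0 = trans (coord-expand x) (sum-≈0 (λ l → trans (*-congʳ (coord≈0 l)) (zeroˡ (β l))))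

  coord-sum : ∀ {t} (c : Fin t → Carrier) → (∀ j → K (c j)) → (z : Fin t → Carrier)
    → ∀ l → coord (∑[ j < t ] (c j * z j)) l ≈ ∑[ j < t ] (c j * coord (z j) l)
  coord-sum {t} c c∈K z = coord-unique _ _ (λ l → sum-∈K (λ j → K.closed-* (c∈K j) (coord-∈K (z j) l))) (begin
    sum (λ j → c j * z j)                                  ≈⟨ sum-cong-≋ (λ j → *-congˡ (coord-expand (z j))) ⟩
    sum (λ j → c j * sum (λ l → coord (z j) l * β l))
      ≈⟨ sum-cong-≋ (λ j → *-distribˡ-sum (c j) (λ l → coord (z j) l * β l)) ⟩
    sum (λ j → sum (λ l → c j * (coord (z j) l * β l)))     ≈⟨ ∑-comm (λ j l → c j * (coord (z j) l * β l)) ⟩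
    sum (λ l → sum (λ j → c j * (coord (z j) l * β l)))
      ≈⟨ sum-cong-≋ (λ l → sum-cong-≋ (λ j → sym (*-assoc (c j) _ (β l)))) ⟩
    sum (λ l → sum (λ j → c j * coord (z j) l * β l))
      ≈⟨ sum-cong-≋ (λ l → sym (*-distribʳ-sum (β l) (λ j → c j * coord (z j) l))) ⟩
    sum (λ l → sum (λ j → c j * coord (z j) l) * β l)       ∎)

  sum-≈0-from-coords : ∀ {t} (z c : Fin t → Carrier) → (∀ j → K (c j))
    → (∀ l → ∑[ j < t ] (coord (z j) l * c j) ≈ 0#) → ∑[ j < t ] (z j * c j) ≈ 0#
  sum-≈0-from-coords z c c∈K coords≈0 = trans (sum-cong-≋ (λ j → *-comm (z j) (c j))) (coord≈0⇒≈0 _ λ l →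
    trans (coord-sum c c∈K z l) (trans (sum-cong-≋ (λ j → *-comm (c j) _)) (coords≈0 l)))

module KLinearConditions (L : CommutativeRing 0ℓ 0ℓ) (L-field : IsField L)
                         (K : Scalars L) (K-subfield : IsSubfield L K)
                         (K-≈0? : ∀ {x} → K x → Dec (CommutativeRing._≈_ L x (CommutativeRing.0# L)))
                         {m : ℕ} (K-basis : ExtDegree L K (suc m)) where
  open CommutativeRing L hiding (zero)
  open IsField L-field
  open Sums L
  open Spans L
  open Kernels L L-field K K-subfield K-≈0?
  open Coordinates L K K-subfield K-basis
  open SetoidReasoning setoid
  private module K = IsSubfield K-subfield

  -- Each row of Y amounts to suc m K-equations, one per coordinate, except row 0 whose coordinate 0 vanishes.
  kernelFamily-overL : ∀ {c t s} → m ℕ.+ c ℕ.* suc m ℕ.+ s ℕ.≤ t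
    → (Y : Fin (suc c) → Fin t → Carrier) → (∀ j → coord (Y zero j) zero ≈ 0#) → KernelFamily Y s
  kernelFamily-overL {c} {t} {s} le Y Y₀₀≈0 = record
    { vec = vec ; vec-∈K = vec-∈K ; vec-kernel = kernel ; vec-indep = vec-indep }
    where
    coords₀ : Fin m → Fin t → Carrier
    coords₀ l j = coord (Y zero j) (suc l)
    coords : Fin c → Fin (suc m) → Fin t → Carrier
    coords e l j = coord (Y (suc e) j) l
    A : Fin (m ℕ.+ c ℕ.* suc m) → Fin t → Carrier
    A = coords₀ ++ concat coords
    A∈K : ∀ row j → K (A row j)
    A∈K row j with splitAt m row
    ... | inj₁ _ = coord-∈K _ _
    ... | inj₂ _ = coord-∈K _ _
    open KernelFamily (kernelFamily le A A∈K)
    top-row : ∀ l → A (l ↑ˡ c ℕ.* suc m) ≡ coords₀ l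
    top-row l = lookup-++ˡ coords₀ (concat coords) l
    lower-row : ∀ e l → A (m ↑ʳ combine e l) ≡ coords e l
    lower-row e l = ≡.trans (lookup-++ʳ coords₀ (concat coords) (combine e l)) (lookup-concat coords e l)
    kernel : ∀ p e → sum (λ j → Y e j * vec p j) ≈ 0#
    kernel p zero    = sum-≈0-from-coords (Y zero) (vec p) (vec-∈K p) λ where
      zero    → sum-≈0 (λ j → trans (*-congʳ (Y₀₀≈0 j)) (zeroˡ (vec p j)))
      (suc l) → trans (sum-cong-≋ λ j → *-congʳ (reflexive (≡.cong-app (≡.sym (top-row l)) j)))
                      (vec-kernel p (l ↑ˡ c ℕ.* suc m))
    kernel p (suc e) = sum-≈0-from-coords (Y (suc e)) (vec p) (vec-∈K p) λ l →
      trans (sum-cong-≋ λ j → *-congʳ (reflexive (≡.cong-app (≡.sym (lower-row e l)) j)))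
            (vec-kernel p (m ↑ʳ combine e l))

  record VanishingFunctional {N t} (x : Fin t → Fin N → Carrier) : Set where
    field
      a          : Fin N → Carrier
      pivot      : Fin N
      a-pivot≉0  : ¬ a pivot ≈ 0#
      a-vanishes : ∀ j → coord (∑[ i < N ] (a i * x j i)) zero ≈ 0#

  -- a i = Σ_l α (i , l) β l for a nonzero K-solution α of the t equations
  -- coord₀ (Σ_{i,l} α (i , l) β l x j i) = 0 in N * suc m unknowns.
  vanishingFunctional : ∀ {N t} → t ℕ.+ 1 ℕ.≤ N ℕ.* suc m → (x : Fin t → Fin N → Carrier)
    → VanishingFunctional x
  vanishingFunctional {N} {t} le x =
    record { a = a ; pivot = i₀ ; a-pivot≉0 = a-i₀≉0 ; a-vanishes = a-vanishes }
    where
    Y : Fin t → Fin (N ℕ.* suc m) → Carrier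
    Y j = concat (λ i l → β l * x j i)
    open KernelFamily (kernelFamily le (λ j col → coord (Y j col) zero) (λ j col → coord-∈K _ zero))
    α = vec zero
    α-nonzero : Σ (Fin (N ℕ.* suc m)) λ col → ¬ α col ≈ 0#
    α-nonzero with ≈0-or-nonzero α (vec-∈K zero)
    ... | inj₁ α≈0 = ⊥-elim (IsLinIndep⇒nonzero {S = K} {v = vec} K.has-0 K.has-1 1≉0 vec-indep zero α≈0)
    ... | inj₂ α≉0 = α≉0
    col₀ = proj₁ α-nonzero
    i₀ = proj₁ (remQuot {N} (suc m) col₀)
    a : Fin N → Carrier
    a i = ∑[ l < suc m ] (α (combine i l) * β l)
    a-i₀≉0 : ¬ a i₀ ≈ 0#
    a-i₀≉0 a-i₀≈0 = proj₂ α-nonzero (≡.subst (λ col → α col ≈ 0#) (combine-remQuot {N} (suc m) col₀)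
      (β-indep (λ l → α (combine i₀ l)) (λ l → vec-∈K zero (combine i₀ l)) a-i₀≈0
               (proj₂ (remQuot {N} (suc m) col₀))))
    a-as-α : ∀ j → ∑[ i < N ] (a i * x j i) ≈ ∑[ col < N ℕ.* suc m ] (α col * Y j col)
    a-as-α j = begin
      sum (λ i → a i * x j i)
        ≈⟨ sum-cong-≋ (λ i → *-distribʳ-sum (x j i) (λ l → α (combine i l) * β l)) ⟩
      ∑[ i < N ] ∑[ l < suc m ] (α (combine i l) * β l * x j i)
        ≈⟨ sum-cong-≋ (λ i → sum-cong-≋ (λ l → *-assoc (α (combine i l)) (β l) (x j i))) ⟩
      ∑[ i < N ] ∑[ l < suc m ] (α (combine i l) * (β l * x j i))
        ≈⟨ sum-cong-≋ (λ i → sum-cong-≋ (λ l →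
             *-congˡ {α (combine i l)} (reflexive (lookup-concat (λ i l → β l * x j i) i l)))) ⟨
      ∑[ i < N ] ∑[ l < suc m ] (α (combine i l) * Y j (combine i l))
        ≈⟨ sum-combine N (suc m) (λ col → α col * Y j col) ⟨
      sum (λ col → α col * Y j col) ∎
    a-vanishes : ∀ j → coord (∑[ i < N ] (a i * x j i)) zero ≈ 0#
    a-vanishes j = trans (coord-cong (a-as-α j) zero) (trans (coord-sum α (vec-∈K zero) (Y j) zero)
      (trans (sum-cong-≋ (λ col → *-comm (α col) _)) (vec-kernel zero j)))

-- The h-dimensional kernel of a on ⟨w 0, w ∘ J⟩, spanned by the b j = w (J j) - (a (J j) / a 0) w 0.
module Sections (L : CommutativeRing 0ℓ 0ℓ) (L-field : IsField L) {k h c : ℕ}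
                (w : Fin (suc (h ℕ.+ c)) → Vect L k) (a : Fin (suc (h ℕ.+ c)) → CommutativeRing.Carrier L)
                (a₀≉0 : ¬ CommutativeRing._≈_ L (a zero) (CommutativeRing.0# L)) where
  open CommutativeRing L hiding (zero)
  open IsField L-field
  open Sums L
  open Spans L
  open SetoidReasoning setoid

  J : Fin h → Fin (suc (h ℕ.+ c))
  J j = suc (j ↑ˡ c)

  Z : Fin c → Fin (suc (h ℕ.+ c))
  Z z = suc (h ↑ʳ z)

  private
    a₀⁻¹ = proj₁ (inverse (a zero) a₀≉0)
    a₀*a₀⁻¹≈1 = proj₂ (inverse (a zero) a₀≉0)

  γ : Fin h → Carrier
  γ j = a (J j) * a₀⁻¹

  b : Fin h → Vect L k
  b j κ = w (J j) κ - γ j * w zero κ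

  section : Vect L k → Set
  section = InSpan L (AllL L) b

  lifted : (Fin h → Carrier) → Fin (suc (h ℕ.+ c)) → Carrier
  lifted μ = - ∑[ j < h ] (μ j * γ j) ∷ (μ ++ λ _ → 0#)

  lincomb-b : ∀ μ → lincomb L μ b ≈ᵥ lincomb L (lifted μ) w
  lincomb-b μ κ = begin
    lincomb L μ b κ                                                  ≡⟨ lincomb-apply μ b κ ⟩
    ∑[ j < h ] (μ j * (w (J j) κ - γ j * w zero κ))
      ≈⟨ sum-cong-≋ (λ j → trans (distribˡ (μ j) _ _) (+-congˡ (trans (sym (-‿distribʳ-* (μ j) _))
                                                                     (-‿cong (sym (*-assoc (μ j) (γ j) _)))))) ⟩
    ∑[ j < h ] (μ j * w (J j) κ + - (μ j * γ j * w zero κ))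
      ≈⟨ ∑-distrib-+ (λ j → μ j * w (J j) κ) (λ j → - (μ j * γ j * w zero κ)) ⟩
    ∑[ j < h ] (μ j * w (J j) κ) + ∑[ j < h ] (- (μ j * γ j * w zero κ))
      ≈⟨ +-congˡ (trans (sum-neg (λ j → μ j * γ j * w zero κ))
                        (-‿cong (sym (*-distribʳ-sum (w zero κ) (λ j → μ j * γ j))))) ⟩
    ∑[ j < h ] (μ j * w (J j) κ) + - (∑[ j < h ] (μ j * γ j) * w zero κ)
      ≈⟨ +-cong (reflexive (≡.sym (lincomb-apply μ (w ∘ J) κ))) (-‿distribˡ-* _ (w zero κ)) ⟩
    lincomb L μ (w ∘ J) κ + lifted μ zero * w zero κ
      ≈⟨ +-comm _ _ ⟩
    lifted μ zero * w zero κ + lincomb L μ (w ∘ J) κ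
      ≈⟨ +-congˡ (lincomb-++ μ (w ∘ suc) κ) ⟨
    lincomb L (lifted μ) w κ                                         ∎

  section-hasDim : IsLinIndep L (AllL L) w → HasDim L (AllL L) section h
  section-hasDim w-indep = b , InSpan-member {AllL L} _ _ b , b-indep , λ _ x∈section → x∈section
    where
    b-indep : IsLinIndep L (AllL L) b
    b-indep μ _ μb≈0 j = trans (reflexive (≡.sym (lookup-++ˡ μ _ j)))
      (w-indep (lifted μ) _ (λ κ → trans (sym (lincomb-b μ κ)) (μb≈0 κ)) (J j))

  pivot-coefficient : (X : Fin (suc (h ℕ.+ c)) → Carrier) → (∀ z → X (Z z) ≈ 0#)
    → ∑[ i < suc (h ℕ.+ c) ] (a i * X i) ≈ 0# → X zero ≈ lifted (X ∘ J) zero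
  pivot-coefficient X XZ≈0 aX≈0 = begin
    X zero                       ≈⟨ *-identityˡ _ ⟨
    1# * X zero                  ≈⟨ *-congʳ (trans (*-comm a₀⁻¹ _) a₀*a₀⁻¹≈1) ⟨
    a₀⁻¹ * a zero * X zero       ≈⟨ *-assoc _ _ _ ⟩
    a₀⁻¹ * (a zero * X zero)     ≈⟨ *-congˡ a₀X₀≈-S ⟩
    a₀⁻¹ * - S                   ≈⟨ -‿distribʳ-* _ _ ⟨
    - (a₀⁻¹ * S)                 ≈⟨ -‿cong (*-distribˡ-sum a₀⁻¹ (λ j → a (J j) * X (J j))) ⟩
    - ∑[ j < h ] (a₀⁻¹ * (a (J j) * X (J j)))
      ≈⟨ -‿cong (sum-cong-≋ (λ j → trans (sym (*-assoc a₀⁻¹ (a (J j)) (X (J j))))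
                                    (trans (*-comm _ (X (J j))) (*-congˡ (*-comm a₀⁻¹ (a (J j))))))) ⟩
    - ∑[ j < h ] (X (J j) * γ j) ∎
    where
    S = ∑[ j < h ] (a (J j) * X (J j))
    a₀X₀≈-S : a zero * X zero ≈ - S
    a₀X₀≈-S = +-inverseʳ-unique S _ (begin
      S + a zero * X zero              ≈⟨ +-comm _ _ ⟩
      a zero * X zero + S              ≈⟨ +-congˡ (+-identityʳ S) ⟨
      a zero * X zero + (S + 0#)
        ≈⟨ +-congˡ (+-congˡ (sum-≈0 (λ z → trans (*-congˡ (XZ≈0 z)) (zeroʳ (a (Z z)))))) ⟨
      a zero * X zero + (S + ∑[ z < c ] (a (Z z) * X (Z z)))
        ≈⟨ +-congˡ (sum-++ h c (λ i → a (suc i) * X (suc i))) ⟨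
      ∑[ i < suc (h ℕ.+ c) ] (a i * X i) ≈⟨ aX≈0 ⟩
      0#                               ∎)

  section-member : (X : Fin (suc (h ℕ.+ c)) → Carrier) → (∀ z → X (Z z) ≈ 0#)
    → ∑[ i < suc (h ℕ.+ c) ] (a i * X i) ≈ 0# → section (lincomb L X w)
  section-member X XZ≈0 aX≈0 = X ∘ J , _ , λ κ →
    trans (lincomb-cong {v = w} X≈lifted (λ _ _ → refl) κ) (sym (lincomb-b (X ∘ J) κ))
    where
    X≈lifted : ∀ i → X i ≈ lifted (X ∘ J) i
    X≈lifted zero    = pivot-coefficient X XZ≈0 aX≈0
    X≈lifted (suc i) = ≈-by-splitAt
      (λ j → reflexive (≡.sym (lookup-++ˡ (X ∘ J) _ j)))
      (λ z → trans (XZ≈0 z) (reflexive (≡.sym (lookup-++ʳ (X ∘ J) _ z)))) i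

2+h+h≡2*[1+h] : ∀ h → suc (suc h ℕ.+ h) ≡ 2 ℕ.* suc h
2+h+h≡2*[1+h] = solve-∀

m+h[1+m]+[1+r]≡r+[1+h][1+m] : ∀ m h r → m ℕ.+ h ℕ.* suc m ℕ.+ suc r ≡ r ℕ.+ suc h ℕ.* suc m
m+h[1+m]+[1+r]≡r+[1+h][1+m] = solve-∀

r+hm+1≤2hm : ∀ {h m r} → r ℕ.< h ℕ.* m → r ℕ.+ h ℕ.* m ℕ.+ 1 ℕ.≤ 2 ℕ.* h ℕ.* m
r+hm+1≤2hm {h} {m} {r} r<hm = begin
  r ℕ.+ h ℕ.* m ℕ.+ 1         ≡⟨ ℕₚ.+-comm (r ℕ.+ h ℕ.* m) 1 ⟩
  suc r ℕ.+ h ℕ.* m           ≤⟨ +-monoˡ-≤ (h ℕ.* m) r<hm ⟩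
  h ℕ.* m ℕ.+ h ℕ.* m         ≡⟨ double h m ⟩
  2 ℕ.* h ℕ.* m               ∎
  where
  open ≤-Reasoning
  double : ∀ h m → h ℕ.* m ℕ.+ h ℕ.* m ≡ 2 ℕ.* h ℕ.* m
  double = solve-∀

module Evasiveness (L : CommutativeRing 0ℓ 0ℓ) (L-field : IsField L) (K : Scalars L) (K-subfield : IsSubfield L K)
                   (K-≈0? : ∀ {x} → K x → Dec (CommutativeRing._≈_ L x (CommutativeRing.0# L)))
                   {m : ℕ} (K-basis : ExtDegree L K (suc m))
                   {k : ℕ} {U : Vect L k → Set} (U-subspace : IsSubspace L K U) where
  open CommutativeRing L hiding (zero)
  open Sums L
  open Spans L
  open Subfield L K K-subfield
  open Kernels L L-field K K-subfield K-≈0?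
  open Coordinates L K K-subfield K-basis
  open KLinearConditions L L-field K K-subfield K-≈0? K-basis

  record RichSubspace (h s : ℕ) : Set₁ where
    field
      H          : Vect L k → Set
      H-subspace : IsSubspace L (AllL L) H
      H-dim      : HasDim L (AllL L) H h
      u          : Fin s → Vect L k
      u∈U∩H      : ∀ p → U (u p) × H (u p)
      u-indep    : IsLinIndep L K u

  RichSubspace⇒¬evasive : ∀ {h r} → RichSubspace h (suc r) → ¬ IsEvasive L K k h r U
  RichSubspace⇒¬evasive {r = r} rich evasive = 1+n≰n (evasive H H-subspace H-dim (suc r) u u∈U∩H u-indep)
    where open RichSubspace rich

  richSubspace : ∀ {h c t s} → m ℕ.+ c ℕ.* suc m ℕ.+ s ℕ.≤ t
    → (w : Fin (suc (h ℕ.+ c)) → Vect L k) → IsLinIndep L (AllL L) w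
    → (v : Fin t → Vect L k) → (∀ j → U (v j)) → IsLinIndep L K v
    → (x : Fin t → Fin (suc (h ℕ.+ c)) → Carrier) → (∀ j → v j ≈ᵥ lincomb L (x j) w)
    → (a : Fin (suc (h ℕ.+ c)) → Carrier) → ¬ a zero ≈ 0#
    → (∀ j → coord (∑[ i < suc (h ℕ.+ c) ] (a i * x j i)) zero ≈ 0#)
    → RichSubspace h s
  richSubspace {h} {c} {t} {s} le w w-indep v v∈U v-indep x v≈xw a a₀≉0 a-vanishes = record
    { H = section ; H-subspace = InSpan-isSubspace b ; H-dim = section-hasDim w-indep
    ; u = u ; u∈U∩H = λ p → u∈U p , u∈section p ; u-indep = IsLinIndep-lincomb vec-∈K vec-indep v-indep }
    where
    open Sections L L-field {h = h} {c} w a a₀≉0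
    Y : Fin (suc c) → Fin t → Carrier
    Y = (λ j → ∑[ i < suc (h ℕ.+ c) ] (a i * x j i)) ∷ λ z j → x j (Z z)
    open KernelFamily (kernelFamily-overL le Y a-vanishes)
    u : Fin s → Vect L k
    u p = lincomb L (vec p) v
    u∈U : ∀ p → U (u p)
    u∈U p = lincomb-closed U-subspace (vec-∈K p) v∈U
    X : Fin s → Fin (suc (h ℕ.+ c)) → Carrier
    X p = lincomb L (vec p) x
    u≈Xw : ∀ p → u p ≈ᵥ lincomb L (X p) w
    u≈Xw p κ = trans (lincomb-cong {c = vec p} (λ _ → refl) v≈xw κ) (lincomb-lincomb (vec p) x w κ)
    u∈section : ∀ p → section (u p)
    u∈section p = IsSubspace.respects (InSpan-isSubspace b) (λ κ → sym (u≈Xw p κ))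
      (section-member (X p) XZ≈0 aX≈0)
      where
      XZ≈0 : ∀ z → X p (Z z) ≈ 0#
      XZ≈0 z = trans (reflexive (lincomb-apply (vec p) x (Z z)))
        (trans (sum-cong-≋ (λ j → *-comm (vec p j) _)) (vec-kernel p (suc z)))
      aX≈0 : ∑[ i < suc (h ℕ.+ c) ] (a i * X p i) ≈ 0#
      aX≈0 = trans (sum-*-lincomb a (vec p) x)
        (trans (sum-cong-≋ (λ j → *-comm (vec p j) _)) (vec-kernel p zero))

  richSubspace-in-2h : ∀ {h r} → r ℕ.< suc h ℕ.* suc m → ∀ {W} → HasDim L (AllL L) W (2 ℕ.* suc h)
    → (v : Fin (r ℕ.+ suc h ℕ.* suc m) → Vect L k) → (∀ j → U (v j) × W (v j)) → IsLinIndep L K v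
    → RichSubspace (suc h) (suc r)
  richSubspace-in-2h {h} {r} r<hm (w , _ , w-indep , w-spans) v v∈U∩W v-indep =
    richSubspace (≤-reflexive (m+h[1+m]+[1+r]≡r+[1+h][1+m] m h r))
      (w ∘ σ) (IsLinIndep-permute {S = AllL L} π {w} w-indep)
      v (proj₁ ∘ v∈U∩W) v-indep (λ j → x j ∘ σ) (λ j κ → trans (v≈xw j κ) (lincomb-permute π (x j) w κ))
      (a ∘ σ) a-pivot≉0 (λ j → trans (coord-cong (sym (∑-permute (λ i → a i * x j i) π)) zero) (a-vanishes j))
    where
    x : Fin (r ℕ.+ suc h ℕ.* suc m) → Fin (2 ℕ.* suc h) → Carrier
    x j = proj₁ (w-spans (v j) (proj₂ (v∈U∩W j)))
    v≈xw : ∀ j → v j ≈ᵥ lincomb L (x j) w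
    v≈xw j = proj₂ (proj₂ (w-spans (v j) (proj₂ (v∈U∩W j))))
    open VanishingFunctional (vanishingFunctional (r+hm+1≤2hm {suc h} {suc m} r<hm) x)
    π : Permutation (suc (suc h ℕ.+ h)) (2 ℕ.* suc h)
    π = insert zero pivot (cast-id (ℕₚ.suc-injective (2+h+h≡2*[1+h] h)))
    σ = π ⟨$⟩ʳ_

open import Data.Nat using (ℕ; _+_; _*_; _∸_; _≤_; _<_)

proposition3p2 : (L : CommutativeRing 0ℓ 0ℓ) → IsField L
    → (K : CommutativeRing.Carrier L → Set) → IsSubfield L K
    → (q m n k h r : ℕ) → IsPrimePower q → HasCard L K q → ExtDegree L K m
    → (U : Vect L k → Set) → IsSystem L K n k U
    → 1 ≤ h → 2 * h < k → r < h * m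
    → IsEvasive L K k h r U
    → IsEvasive L K k (2 * h) (r + h * m ∸ 1) U
proposition3p2 L L-field K K-subfield q zero n k h r _ _ _ U _ _ _ r<h*0 _ =
  ⊥-elim (ℕₚ.n≮0 (≡.subst (r <_) (ℕₚ.*-zeroʳ h) r<h*0))
proposition3p2 L L-field K K-subfield q (suc m) n k (suc h) r _ K-finite K-basis U (U-subspace , _)
               (ℕ.s≤s ℕ.z≤n) _ r<hm evasive W _ W-dim =
  Spans.DimAtMost-∸1 L {K} {V = λ x → U x × W x} (IsSubfield.has-0 K-subfield) λ v v∈U∩W v-indep →
    RichSubspace⇒¬evasive (richSubspace-in-2h r<hm W-dim v v∈U∩W v-indep) evasive
  where
  K-≈0? : ∀ {x} → K x → Dec (CommutativeRing._≈_ L x (CommutativeRing.0# L))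
  K-≈0? x∈K = Subfield.HasCard⇒≈? L K K-subfield K-finite x∈K (IsSubfield.has-0 K-subfield)
  open Evasiveness L L-field K K-subfield K-≈0? K-basis U-subspace
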